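{- Let $k>1$ be an integer. If $(x,y,z)$ is a solution in positive integers of $x^2+(2k-1)^y=k^z$ with $y\in\{3,5\}$, then $z$ is odd. -}

module Defs where

-- Write z = 2w and K = k ^ w. Then (K − x)(K + x) = c ^ y with c = 2k − 1, and the two factors are
-- coprime (a common divisor divides both c ^ y and 2K, but c is coprime to 2k), so K − x = a ^ y and
-- K + x = b ^ y with ab = c. Hence a ^ y + b ^ y = 2 k ^ w with ab + 1 = 2k and a < b. For a = 1 the
-- cofactor (1 + b ^ y)/(1 + b) is a power of k and ≡ y modulo k, which forces k = y, and that fails.
-- For a ≥ 2 the two sides have different sizes unless (y, w) is (3, 2), (5, 3) or (5, 4); in each of
-- these, comparing the equation 2 ^ (w − 1) (a ^ y + b ^ y) = (ab + 1) ^ w coefficientwise bounds a and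
-- pins b to a short range, which is then searched exhaustively.
module Submission where

open import Defs
open import Data.Nat using (ℕ; _+_; _*_; _∸_; _^_; _<_)
open import Data.Nat.Divisibility using (_∣_)
open import Data.Sum using (_⊎_)
open import Relation.Binary.PropositionalEquality using (_≡_)
open import Relation.Nullary using (¬_)

open import Data.Bool using (if_then_else_)
open import Data.Empty using (⊥)
open import Data.List using ([]; _∷_)
open import Data.Nat
open import Data.Nat.Coprimality using (Coprime; coprime-divisor; gcd≡1⇒coprime; 1-coprimeTo; coprime-+)
  renaming (sym to coprime-sym)
open import Data.Nat.Divisibility
open import Data.Nat.GCD using (gcd; gcd[m,n]∣m; gcd[m,n]∣n; gcd[m,n]≢0)
open import Data.Nat.Induction using (<-rec)
open import Data.Nat.Primality using (Prime; prime?; prime⇒irreducible)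
open import Data.Nat.Properties
open import Algebra.Properties.CommutativeSemigroup *-commutativeSemigroup
  using (interchange; xy∙z≈xz∙y; x∙yz≈y∙xz)
open import Data.Nat.Solver using (module +-*-Solver)
open import Data.Nat.Tactic.RingSolver using (solve-∀; solve)
open import Data.Product using (∃; ∃₂; _×_; _,_)
open import Data.Sum using (inj₁; inj₂; [_,_]′)
open import Function using (_∘_)
open import Relation.Binary.PropositionalEquality
open import Relation.Nullary using (Dec)
open import Relation.Nullary.Decidable using (True; toWitness; from-yes; yes; no; _→-dec_; _×-dec_; ¬?)
open import Relation.Nullary.Negation using (contradiction)
open +-*-Solver using (_:+_; _:*_; _:^_; _:=_; con)

private variable a b k m n o : ℕ

^-distribʳ-* : ∀ m n o → (m * n) ^ o ≡ m ^ o * n ^ o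
^-distribʳ-* m n zero    = refl
^-distribʳ-* m n (suc o) = begin
  m * n * (m * n) ^ o     ≡⟨ cong (m * n *_) (^-distribʳ-* m n o) ⟩
  m * n * (m ^ o * n ^ o) ≡⟨ interchange m n (m ^ o) (n ^ o) ⟩
  m * m ^ o * (n * n ^ o) ∎
  where open ≡-Reasoning

^-cancelˡ-< : ∀ n → m ^ n < o ^ n → m < o
^-cancelˡ-< n mⁿ<oⁿ = ≰⇒> (λ o≤m → <⇒≱ mⁿ<oⁿ (^-monoˡ-≤ n o≤m))

m*m<n*n⇒m<n : ∀ m n → m * m < n * n → m < n
m*m<n*n⇒m<n m n m²<n² = ≰⇒> λ n≤m → <⇒≱ m²<n² (*-mono-≤ n≤m n≤m)

m*m*m<n*n*n⇒m<n : ∀ m n → m * m * m < n * n * n → m < n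
m*m*m<n*n*n⇒m<n m n m³<n³ = ≰⇒> λ n≤m → <⇒≱ m³<n³ (*-mono-≤ (*-mono-≤ n≤m n≤m) n≤m)

<⇒∃+suc : ∀ {m n} → m < n → ∃ λ d → m + suc d ≡ n
<⇒∃+suc {m} m<n = let d , 1+m+d≡n = m≤n⇒∃[o]m+o≡n m<n in d , trans (+-suc m d) 1+m+d≡n

m+d≡n⊎n+1+d≡m : ∀ m n → (∃ λ d → m + d ≡ n) ⊎ (∃ λ d → n + suc d ≡ m)
m+d≡n⊎n+1+d≡m m n with m ≤? n
... | yes m≤n = inj₁ (m≤n⇒∃[o]m+o≡n m≤n)
... | no  m≰n = inj₂ (<⇒∃+suc (≰⇒> m≰n))

2*[m*n]≤m*m+n*n : ∀ m n → 2 * (m * n) ≤ m * m + n * n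
2*[m*n]≤m*m+n*n m n = [ ordered , swapped ]′ (≤-total m n)
  where
  ordered : ∀ {m n} → m ≤ n → 2 * (m * n) ≤ m * m + n * n
  ordered {m} m≤n with m≤n⇒∃[o]m+o≡n m≤n
  ... | d , refl = ≤-trans (m≤m+n _ (d * d)) (≤-reflexive (solve (m ∷ d ∷ [])))
  swapped : n ≤ m → 2 * (m * n) ≤ m * m + n * n
  swapped n≤m = subst₂ _≤_ (cong (2 *_) (*-comm n m)) (+-comm (n * n) (m * m)) (ordered n≤m)

3x+1≤x² : ∀ {x} → 4 ≤ x → 3 * x + 1 ≤ x * x
3x+1≤x² {x} 4≤x = begin
  3 * x + 1 ≤⟨ +-monoʳ-≤ (3 * x) (≤-trans (s≤s z≤n) 4≤x) ⟩
  3 * x + x ≡⟨ solve (x ∷ []) ⟩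
  4 * x     ≤⟨ *-monoˡ-≤ x 4≤x ⟩
  x * x     ∎
  where open ≤-Reasoning

^≢-between : ∀ {n m} i w → .{{NonZero n}} → n ^ i < m → m < n ^ suc i → n ^ w ≢ m
^≢-between {n} i w lo hi refl with w ≤? i
... | yes w≤i = <⇒≱ lo (^-monoʳ-≤ n w≤i)
... | no  w≰i = <⇒≱ hi (^-monoʳ-≤ n (≰⇒> w≰i))

-- Coprime factors of a power

coprime-∣ʳ : Coprime m n → o ∣ n → Coprime m o
coprime-∣ʳ c o∣n (i∣m , i∣o) = c (i∣m , ∣-trans i∣o o∣n)

coprime-∣ˡ : Coprime m n → o ∣ m → Coprime o n
coprime-∣ˡ c o∣m = coprime-sym (coprime-∣ʳ (coprime-sym c) o∣m)

coprime-*ˡ : Coprime m o → Coprime n o → Coprime (m * n) o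
coprime-*ˡ m⊥o n⊥o (i∣mn , i∣o) = n⊥o (coprime-divisor (coprime-∣ˡ (coprime-sym m⊥o) i∣o) i∣mn , i∣o)

coprime-^ˡ : ∀ n → Coprime m o → Coprime (m ^ n) o
coprime-^ˡ zero    c (i∣1 , _) = ∣1⇒≡1 i∣1
coprime-^ˡ (suc n) c = coprime-*ˡ c (coprime-^ˡ n c)

coprime-^ʳ : ∀ n → Coprime m o → Coprime m (o ^ n)
coprime-^ʳ n c = coprime-sym (coprime-^ˡ n (coprime-sym c))

coprime[d*e,d+e]⇒coprime[d,e] : ∀ {d e} → Coprime (d * e) (d + e) → Coprime d e
coprime[d*e,d+e]⇒coprime[d,e] c (i∣d , i∣e) = c (∣m⇒∣m*n _ i∣d , ∣m∣n⇒∣m+n i∣d i∣e)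

coprime∧∣^⇒≡1 : ∀ {d c} n → Coprime d c → d ∣ c ^ n → d ≡ 1
coprime∧∣^⇒≡1 {d} {c} n d⊥c d∣cⁿ =
  ∣1⇒≡1 (coprime-divisor (coprime-^ʳ n d⊥c) (subst (d ∣_) (sym (*-identityʳ (c ^ n))) d∣cⁿ))

-- gcd d c ^ n divides c ^ n = d * e and is coprime to e.
gcd[d,c]^n∣d : ∀ {d e} c n → Coprime d e → d * e ≡ c ^ n → gcd d c ^ n ∣ d
gcd[d,c]^n∣d {d} {e} c n d⊥e de≡cⁿ =
  coprime-divisor (coprime-^ˡ n (coprime-∣ˡ d⊥e (gcd[m,n]∣m d c))) (divides (quotient g∣c ^ n) (begin
    e * d                        ≡⟨ *-comm e d ⟩
    d * e                        ≡⟨ de≡cⁿ ⟩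
    c ^ n                        ≡⟨ cong (_^ n) (_∣_.equality g∣c) ⟩
    (quotient g∣c * gcd d c) ^ n ≡⟨ ^-distribʳ-* (quotient g∣c) (gcd d c) n ⟩
    quotient g∣c ^ n * gcd d c ^ n ∎))
  where
  open ≡-Reasoning
  g∣c : gcd d c ∣ c
  g∣c = gcd[m,n]∣n d c

-- Strong induction on c, splitting off g = gcd d c from d.
coprime-*≡^⇒^ : ∀ {d e} c n → .{{NonZero c}} → Coprime d e → d * e ≡ c ^ n →
                ∃₂ λ a b → d ≡ a ^ n × e ≡ b ^ n × a * b ≡ c
coprime-*≡^⇒^ {d} {e} c n = <-rec P step c d e
  where
  P : ℕ → Set
  P c = ∀ d e → .{{NonZero c}} → Coprime d e → d * e ≡ c ^ n →
        ∃₂ λ a b → d ≡ a ^ n × e ≡ b ^ n × a * b ≡ c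
  step : ∀ c → (∀ {h} → h < c → P h) → P c
  step c rec d e d⊥e de≡cⁿ with gcd d c ≟ 1
  ... | yes g≡1 = 1 , c , trans d≡1 (sym (^-zeroˡ n)) , e≡cⁿ , *-identityˡ c
    where
    d≡1 : d ≡ 1
    d≡1 = coprime∧∣^⇒≡1 n (gcd≡1⇒coprime g≡1) (divides e (trans (sym de≡cⁿ) (*-comm d e)))
    e≡cⁿ : e ≡ c ^ n
    e≡cⁿ = trans (sym (*-identityˡ e)) (trans (cong (_* e) (sym d≡1)) de≡cⁿ)
  ... | no g≢1 = lift (rec (quotient-< (gcd[m,n]∣n d c)) d′ e d′⊥e d′e≡hⁿ)
    where
    open ≡-Reasoning
    g h : ℕ
    g = gcd d c
    h = quotient (gcd[m,n]∣n d c)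
    c≡hg : c ≡ h * g
    c≡hg = _∣_.equality (gcd[m,n]∣n d c)
    instance
      g-nonTrivial : NonTrivial g
      g-nonTrivial = n>1⇒nonTrivial (≤∧≢⇒< (n≢0⇒n>0 (gcd[m,n]≢0 d c (inj₂ (≢-nonZero⁻¹ c)))) (g≢1 ∘ sym))
      h-nonZero : NonZero h
      h-nonZero = quotient≢0 (gcd[m,n]∣n d c)
      gⁿ-nonZero : NonZero (g ^ n)
      gⁿ-nonZero = m^n≢0 g n {{nonTrivial⇒nonZero g}}
    d′ : ℕ
    d′ = quotient (gcd[d,c]^n∣d c n d⊥e de≡cⁿ)
    d≡d′gⁿ : d ≡ d′ * g ^ n
    d≡d′gⁿ = _∣_.equality (gcd[d,c]^n∣d c n d⊥e de≡cⁿ)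
    d′⊥e : Coprime d′ e
    d′⊥e = coprime-∣ˡ d⊥e (divides (g ^ n) (trans d≡d′gⁿ (*-comm d′ (g ^ n))))
    d′e≡hⁿ : d′ * e ≡ h ^ n
    d′e≡hⁿ = *-cancelʳ-≡ (d′ * e) (h ^ n) (g ^ n) (begin
      d′ * e * g ^ n   ≡⟨ xy∙z≈xz∙y d′ e (g ^ n) ⟩
      d′ * g ^ n * e   ≡⟨ cong (_* e) d≡d′gⁿ ⟨
      d * e            ≡⟨ de≡cⁿ ⟩
      c ^ n            ≡⟨ cong (_^ n) c≡hg ⟩
      (h * g) ^ n      ≡⟨ ^-distribʳ-* h g n ⟩
      h ^ n * g ^ n    ∎)
    lift : (∃₂ λ a b → d′ ≡ a ^ n × e ≡ b ^ n × a * b ≡ h) →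
           ∃₂ λ a b → d ≡ a ^ n × e ≡ b ^ n × a * b ≡ c
    lift (a′ , b , d′≡a′ⁿ , e≡bⁿ , a′b≡h) = a′ * g , b , d≡[a′g]ⁿ , e≡bⁿ , a′gb≡c
      where
      d≡[a′g]ⁿ : d ≡ (a′ * g) ^ n
      d≡[a′g]ⁿ = trans d≡d′gⁿ (trans (cong (_* g ^ n) d′≡a′ⁿ) (sym (^-distribʳ-* a′ g n)))
      a′gb≡c : a′ * g * b ≡ c
      a′gb≡c = trans (xy∙z≈xz∙y a′ g b) (trans (cong (_* g) a′b≡h) (sym c≡hg))

-- Reduction to a ^ y + b ^ y = 2 k ^ w with ab + 1 = 2k

^2+m≡^2⇒< : ∀ {x m n} → x ^ 2 + m ≡ n ^ 2 → 0 < m → x < n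
^2+m≡^2⇒< {x} eq 0<m = ^-cancelˡ-< 2 (subst (x ^ 2 <_) eq (m<m+n (x ^ 2) 0<m))

^2+m≡[+]^2⇒*≡ : ∀ {x m t} → x ^ 2 + m ≡ (x + t) ^ 2 → t * (t + 2 * x) ≡ m
^2+m≡[+]^2⇒*≡ {x} {m} {t} eq = +-cancelˡ-≡ (x ^ 2) _ _ (trans (sym (square-expand x t)) (sym eq))
  where
  square-expand : ∀ x t → (x + t) ^ 2 ≡ x ^ 2 + t * (t + 2 * x)
  square-expand = +-*-Solver.solve 2 (λ x t → (x :+ t) :^ 2 := x :^ 2 :+ t :* (t :+ con 2 :* x)) refl

even-exponent⇒sum-of-powers : ∀ {k x y w} → 1 < k → 0 < x → x ^ 2 + (2 * k ∸ 1) ^ y ≡ k ^ (w * 2) →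
  ∃₂ λ a b → 1 ≤ a × a < b × a * b + 1 ≡ 2 * k × a ^ y + b ^ y ≡ 2 * k ^ w
even-exponent⇒sum-of-powers {k} {x} {y} {w} 1<k 0<x eq = lift (coprime-*≡^⇒^ c y d⊥e de≡cʸ)
  where
  open ≡-Reasoning
  c : ℕ
  c = 2 * k ∸ 1
  1<2k : 1 < 2 * k
  1<2k = *-monoʳ-≤ 2 (<⇒≤ 1<k)
  c+1≡2k : c + 1 ≡ 2 * k
  c+1≡2k = m∸n+n≡m (<⇒≤ 1<2k)
  instance
    c-nonZero : NonZero c
    c-nonZero = ≢-nonZero λ c≡0 → <⇒≢ 1<2k (trans (cong (_+ 1) (sym c≡0)) c+1≡2k)
  K : ℕ
  K = k ^ w
  x<K : x < K
  x<K = ^2+m≡^2⇒< (trans eq (sym (^-*-assoc k w 2))) (m^n>0 c y)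
  d : ℕ
  d = K ∸ x
  x+d≡K : x + d ≡ K
  x+d≡K = m+[n∸m]≡n (<⇒≤ x<K)
  de≡cʸ : d * (d + 2 * x) ≡ c ^ y
  de≡cʸ = ^2+m≡[+]^2⇒*≡ {x} {c ^ y} {d} (begin
    x ^ 2 + c ^ y ≡⟨ eq ⟩
    k ^ (w * 2)   ≡⟨ ^-*-assoc k w 2 ⟨
    K ^ 2         ≡⟨ cong (_^ 2) x+d≡K ⟨
    (x + d) ^ 2   ∎)
  d+e≡2K : d + (d + 2 * x) ≡ 2 * K
  d+e≡2K = begin
    d + (d + 2 * x) ≡⟨ rearrange d x ⟩
    2 * (x + d)     ≡⟨ cong (2 *_) x+d≡K ⟩
    2 * K           ∎
    where
    rearrange : ∀ d x → d + (d + 2 * x) ≡ 2 * (x + d)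
    rearrange = solve-∀
  c⊥2k : Coprime c (2 * k)
  c⊥2k = subst (Coprime c) c+1≡2k (coprime-sym (coprime-+ (1-coprimeTo c)))
  c⊥2 : Coprime c 2
  c⊥2 = coprime-∣ʳ c⊥2k (m∣m*n k)
  c⊥k : Coprime c k
  c⊥k = coprime-∣ʳ c⊥2k (n∣m*n 2)
  c⊥2K : Coprime c (2 * K)
  c⊥2K = coprime-sym (coprime-*ˡ (coprime-sym c⊥2) (coprime-^ˡ w (coprime-sym c⊥k)))
  d⊥e : Coprime d (d + 2 * x)
  d⊥e = coprime[d*e,d+e]⇒coprime[d,e] (subst₂ Coprime (sym de≡cʸ) (sym d+e≡2K) (coprime-^ˡ y c⊥2K))
  lift : (∃₂ λ a b → d ≡ a ^ y × d + 2 * x ≡ b ^ y × a * b ≡ c) →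
         ∃₂ λ a b → 1 ≤ a × a < b × a * b + 1 ≡ 2 * k × a ^ y + b ^ y ≡ 2 * k ^ w
  lift (a , b , d≡aʸ , e≡bʸ , ab≡c) = a , b , 1≤a , a<b , ab+1≡2k , sum≡
    where
    1≤a : 1 ≤ a
    1≤a = n≢0⇒n>0 λ { refl → ≢-nonZero⁻¹ c (sym ab≡c) }
    a<b : a < b
    a<b = ^-cancelˡ-< y (subst₂ _<_ d≡aʸ e≡bʸ (m<m+n d (≤-trans 0<x (m≤n*m x 2))))
    ab+1≡2k : a * b + 1 ≡ 2 * k
    ab+1≡2k = trans (cong (_+ 1) ab≡c) c+1≡2k
    sum≡ : a ^ y + b ^ y ≡ 2 * k ^ w
    sum≡ = trans (cong₂ _+_ (sym d≡aʸ) (sym e≡bʸ)) d+e≡2K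

b<k : ∀ {a b k} → 2 ≤ a → a * b + 1 ≡ 2 * k → b < k
b<k {a} {b} {k} 2≤a ab+1≡2k = *-cancelˡ-< 2 b k (begin-strict
  2 * b     <⟨ m<m+n (2 * b) z<s ⟩
  2 * b + 1 ≤⟨ +-monoˡ-≤ 1 (*-monoˡ-≤ b 2≤a) ⟩
  a * b + 1 ≡⟨ ab+1≡2k ⟩
  2 * k     ∎)
  where open ≤-Reasoning

ab+1≤b² : ∀ {a b} → a < b → a * b + 1 ≤ b ^ 2
ab+1≤b² {a} {b} a<b = begin
  a * b + 1 ≡⟨ +-comm (a * b) 1 ⟩
  1 + a * b ≤⟨ *-monoˡ-< b {{>-nonZero (≤-<-trans z≤n a<b)}} a<b ⟩
  b * b     ≡⟨ cong (b *_) (*-identityʳ b) ⟨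
  b ^ 2     ∎
  where open ≤-Reasoning

2kʷ<sum-of-powers : ∀ {a b} y w k → 2 * suc w ≤ y → 1 ≤ a → a < b → a * b + 1 ≡ 2 * k → 2 * k ^ suc w < a ^ y + b ^ y
2kʷ<sum-of-powers {a} {b} y w k 2w≤y 1≤a a<b ab+1≡2k = begin-strict
  2 * k ^ suc w          ≤⟨ *-monoˡ-≤ (k ^ suc w) (^-monoʳ-≤ 2 (s≤s (z≤n {w}))) ⟩
  2 ^ suc w * k ^ suc w  ≡⟨ ^-distribʳ-* 2 k (suc w) ⟨
  (2 * k) ^ suc w        ≡⟨ cong (_^ suc w) ab+1≡2k ⟨
  (a * b + 1) ^ suc w    ≤⟨ ^-monoˡ-≤ (suc w) (ab+1≤b² a<b) ⟩
  (b ^ 2) ^ suc w        ≡⟨ ^-*-assoc b 2 (suc w) ⟩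
  b ^ (2 * suc w)        ≤⟨ ^-monoʳ-≤ b {{>-nonZero (≤-<-trans z≤n a<b)}} 2w≤y ⟩
  b ^ y                  <⟨ m<n+m (b ^ y) (m^n>0 a {{>-nonZero 1≤a}} y) ⟩
  a ^ y + b ^ y          ∎
  where open ≤-Reasoning

sum-of-powers<2kʷ : ∀ {a b} y w k → 1 ≤ y → y ≤ w → 2 ≤ a → a < b → a * b + 1 ≡ 2 * k → a ^ y + b ^ y < 2 * k ^ w
sum-of-powers<2kʷ {a} {b} y w k 1≤y y≤w 2≤a a<b ab+1≡2k = begin-strict
  a ^ y + b ^ y ≤⟨ +-monoˡ-≤ (b ^ y) (^-monoˡ-≤ y (<⇒≤ a<b)) ⟩
  b ^ y + b ^ y <⟨ +-mono-< bʸ<kʸ bʸ<kʸ ⟩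
  k ^ y + k ^ y ≤⟨ +-mono-≤ kʸ≤kʷ kʸ≤kʷ ⟩
  k ^ w + k ^ w ≡⟨ cong (k ^ w +_) (+-identityʳ (k ^ w)) ⟨
  2 * k ^ w     ∎
  where
  open ≤-Reasoning
  bʸ<kʸ : b ^ y < k ^ y
  bʸ<kʸ = ^-monoˡ-< y {{>-nonZero 1≤y}} (b<k 2≤a ab+1≡2k)
  kʸ≤kʷ : k ^ y ≤ k ^ w
  kʸ≤kʷ = ^-monoʳ-≤ k {{>-nonZero (≤-<-trans z≤n (b<k 2≤a ab+1≡2k))}} y≤w

sum-of-powers-scaled : ∀ {a b} y w k → a * b + 1 ≡ 2 * k → a ^ y + b ^ y ≡ 2 * k ^ suc w →
                       2 ^ w * (a ^ y + b ^ y) ≡ (a * b + 1) ^ suc w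
sum-of-powers-scaled {a} {b} y w k ab+1≡2k sum≡ = begin
  2 ^ w * (a ^ y + b ^ y)   ≡⟨ cong (2 ^ w *_) sum≡ ⟩
  2 ^ w * (2 * k ^ suc w)   ≡⟨ x∙yz≈y∙xz (2 ^ w) 2 (k ^ suc w) ⟩
  2 * (2 ^ w * k ^ suc w)   ≡⟨ *-assoc 2 (2 ^ w) (k ^ suc w) ⟨
  2 ^ suc w * k ^ suc w     ≡⟨ ^-distribʳ-* 2 k (suc w) ⟨
  (2 * k) ^ suc w           ≡⟨ cong (_^ suc w) ab+1≡2k ⟨
  (a * b + 1) ^ suc w       ∎
  where open ≡-Reasoning

-- The case a = 1

b+1≡2k⇒b≡1+2j : ∀ {b k} → 1 < b → b + 1 ≡ 2 * k → ∃ λ j → 1 ≤ j × b ≡ 1 + 2 * j × k ≡ 1 + j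
b+1≡2k⇒b≡1+2j {b} {zero}  _   b+1≡0  = contradiction (trans (+-comm 1 b) b+1≡0) λ ()
b+1≡2k⇒b≡1+2j {b} {suc j} 1<b b+1≡2k = j , 1≤j , b≡1+2j , refl
  where
  b≡1+2j : b ≡ 1 + 2 * j
  b≡1+2j = +-cancelʳ-≡ 1 b (1 + 2 * j) (trans b+1≡2k (identity j))
    where
    identity : ∀ j → 2 * suc j ≡ 1 + 2 * j + 1
    identity = solve-∀
  1≤j : 1 ≤ j
  1≤j = n≢0⇒n>0 λ { refl → <⇒≢ 1<b (sym b≡1+2j) }

power≡residue : ∀ {p s q r} n w → p ≡ n ^ w → p + n * s ≡ n * q + r → p ≡ 1 ⊎ n ∣ r
power≡residue n zero    p≡1 _  = inj₁ p≡1
power≡residue {p} {s} {q} n (suc w) p≡nⁿ eq =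
  inj₂ (∣m+n∣m⇒∣n (subst (n ∣_) eq (∣m∣n⇒∣m+n n∣p (m∣m*n s))) (m∣m*n q))
  where
  n∣p : n ∣ p
  n∣p = subst (n ∣_) (sym p≡nⁿ) (m∣m*n (n ^ w))

power≡prime-residue : ∀ {r p s q} n w → Prime r → 1 < n → p ≡ n ^ w → p + n * s ≡ n * q + r → p ≡ 1 ⊎ n ≡ r
power≡prime-residue {r} n w r-prime 1<n p≡nʷ eq with power≡residue n w p≡nʷ eq
... | inj₁ p≡1 = inj₁ p≡1
... | inj₂ n∣r with prime⇒irreducible r-prime n∣r
...   | inj₁ n≡1 = contradiction n≡1 (>⇒≢ 1<n)
...   | inj₂ n≡r = inj₂ n≡r

-- With b = 1 + 2j, the cofactor (1 + b ^ y) / (1 + b) is ≡ y modulo 1 + j, since b ≡ −1 modulo 2 (1 + j).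
cofactor₃-residue : ∀ j → 1 + 2 * j + 4 * (j * j) + (1 + j) * 2 ≡ (1 + j) * (4 * j) + 3
cofactor₃-residue = solve-∀

cofactor₃-excluded : ∀ j w → 1 ≤ j → 1 + 2 * j + 4 * (j * j) ≡ 1 ⊎ 1 + j ≡ 3 → 1 + 2 * j + 4 * (j * j) ≢ (1 + j) ^ w
cofactor₃-excluded (suc _) w _ (inj₁ ())
cofactor₃-excluded _       w _ (inj₂ refl) c≡ = ^≢-between 2 w (from-yes (9 <? 21)) (from-yes (21 <? 27)) (sym c≡)

cofactor₃-not-power : ∀ j w → 1 ≤ j → 1 + 2 * j + 4 * (j * j) ≢ (1 + j) ^ w
cofactor₃-not-power j w 1≤j c≡ = cofactor₃-excluded j w 1≤j
  (power≡prime-residue {s = 2} {q = 4 * j} (1 + j) w (from-yes (prime? 3)) (s≤s 1≤j) c≡ (cofactor₃-residue j)) c≡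

cofactor₅-residue : ∀ j → 1 + 4 * j + 16 * (j * j) + 24 * (j * j * j) + 16 * (j * j * j * j) + (1 + j) * 4
                        ≡ (1 + j) * (8 * j + 8 * (j * j) + 16 * (j * j * j)) + 5
cofactor₅-residue = solve-∀

cofactor₅-excluded : ∀ j w → 1 ≤ j → 1 + 4 * j + 16 * (j * j) + 24 * (j * j * j) + 16 * (j * j * j * j) ≡ 1 ⊎ 1 + j ≡ 5 →
                     1 + 4 * j + 16 * (j * j) + 24 * (j * j * j) + 16 * (j * j * j * j) ≢ (1 + j) ^ w
cofactor₅-excluded (suc _) w _ (inj₁ ())
cofactor₅-excluded _       w _ (inj₂ refl) c≡ =
  ^≢-between 5 w (from-yes (3125 <? 5905)) (from-yes (5905 <? 15625)) (sym c≡)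

cofactor₅-not-power : ∀ j w → 1 ≤ j → 1 + 4 * j + 16 * (j * j) + 24 * (j * j * j) + 16 * (j * j * j * j) ≢ (1 + j) ^ w
cofactor₅-not-power j w 1≤j c≡ = cofactor₅-excluded j w 1≤j
  (power≡prime-residue {s = 4} {q = 8 * j + 8 * (j * j) + 16 * (j * j * j)} (1 + j) w (from-yes (prime? 5)) (s≤s 1≤j) c≡
    (cofactor₅-residue j)) c≡

2n*c≡2nʷ⁺¹⇒c≡nʷ : ∀ {c} n w → .{{NonZero n}} → 2 * n * c ≡ 2 * n ^ suc w → c ≡ n ^ w
2n*c≡2nʷ⁺¹⇒c≡nʷ {c} n w eq = *-cancelˡ-≡ c (n ^ w) (2 * n) {{m*n≢0 2 n}} (trans eq (sym (*-assoc 2 n (n ^ w))))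

no-solution-a≡1 : ∀ {y} → y ≡ 3 ⊎ y ≡ 5 → ∀ j w → 1 ≤ j → 1 + (1 + 2 * j) ^ y ≢ 2 * (1 + j) ^ suc w
no-solution-a≡1 (inj₁ refl) j w 1≤j eq =
  cofactor₃-not-power j w 1≤j (2n*c≡2nʷ⁺¹⇒c≡nʷ (1 + j) w (trans (sym (factorise j)) eq))
  where
  factorise : ∀ j → 1 + (1 + 2 * j) ^ 3 ≡ 2 * (1 + j) * (1 + 2 * j + 4 * (j * j))
  factorise = +-*-Solver.solve 1 (λ j → con 1 :+ (con 1 :+ con 2 :* j) :^ 3 :=
                                        con 2 :* (con 1 :+ j) :* (con 1 :+ con 2 :* j :+ con 4 :* (j :* j))) refl
no-solution-a≡1 (inj₂ refl) j w 1≤j eq =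
  cofactor₅-not-power j w 1≤j (2n*c≡2nʷ⁺¹⇒c≡nʷ (1 + j) w (trans (sym (factorise j)) eq))
  where
  factorise : ∀ j → 1 + (1 + 2 * j) ^ 5 ≡ 2 * (1 + j) * (1 + 4 * j + 16 * (j * j) + 24 * (j * j * j) + 16 * (j * j * j * j))
  factorise = +-*-Solver.solve 1 (λ j → con 1 :+ (con 1 :+ con 2 :* j) :^ 5 :=
                                        con 2 :* (con 1 :+ j) :* (con 1 :+ con 4 :* j :+ con 16 :* (j :* j)
                                          :+ con 24 :* (j :* j :* j) :+ con 16 :* (j :* j :* j :* j))) refl

-- The exponent pairs (3, 2) and (5, 4)

no-solution-below : (f g : ℕ → ℕ → ℕ) (A B : ℕ) →
  True (allUpTo? (λ a → allUpTo? (λ b → a <? b →-dec ¬? (f a b ≟ g a b)) B) A) →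
  a < A → b < B → a < b → f a b ≢ g a b
no-solution-below f g A B checked a<A b<B = toWitness checked a<A b<B

2A+Rb²≡2kb+1⇒2A≤k²+1 : ∀ {A R b k} → 2 * A + R * (b * b) ≡ 2 * (k * b) + 1 → 2 * A ≤ k * k + 1
2A+Rb²≡2kb+1⇒2A≤k²+1 {A} {zero} {b} {k} eq =
  contradiction (trans (sym (+-identityʳ (2 * A))) (trans eq (+-comm (2 * (k * b)) 1))) (even≢odd A (k * b))
2A+Rb²≡2kb+1⇒2A≤k²+1 {A} {suc R} {b} {k} eq = +-cancelˡ-≤ (b * b) _ _ (begin
  b * b + 2 * A               ≡⟨ +-comm (b * b) (2 * A) ⟩
  2 * A + b * b               ≤⟨ +-monoʳ-≤ (2 * A) (m≤m+n (b * b) (R * (b * b))) ⟩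
  2 * A + suc R * (b * b)     ≡⟨ eq ⟩
  2 * (k * b) + 1             ≤⟨ +-monoˡ-≤ 1 (2*[m*n]≤m*m+n*n k b) ⟩
  k * k + b * b + 1           ≡⟨ solve (k ∷ b ∷ []) ⟩
  b * b + (k * k + 1)         ∎)
  where open ≤-Reasoning

-- The leading terms a²b² and 2b³ force a² ≈ 2b: if a² ≤ 2b the surplus (2b − a²) b² has nowhere to go,
-- and if a² > 2b then b² < 2a³ and a² < 4b bound both variables.
no-solution-3-2 : ∀ {a b} → 2 ≤ a → a < b → 2 * (a ^ 3 + b ^ 3) ≢ (a * b + 1) ^ 2
no-solution-3-2 {a} {b} 2≤a a<b eq = [ case-a²≤2b , case-2b<a² ]′ (m+d≡n⊎n+1+d≡m (a * a) (2 * b))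
  where
  open ≤-Reasoning
  expanded : 2 * (a * a * a) + 2 * (b * b * b) ≡ a * a * (b * b) + 2 * (a * b) + 1
  expanded = trans (lhs a b) (trans eq (rhs a b))
    where
    lhs : ∀ a b → 2 * (a * a * a) + 2 * (b * b * b) ≡ 2 * (a ^ 3 + b ^ 3)
    lhs = +-*-Solver.solve 2 (λ a b → con 2 :* (a :* a :* a) :+ con 2 :* (b :* b :* b) := con 2 :* (a :^ 3 :+ b :^ 3)) refl
    rhs : ∀ a b → (a * b + 1) ^ 2 ≡ a * a * (b * b) + 2 * (a * b) + 1
    rhs = +-*-Solver.solve 2 (λ a b → (a :* b :+ con 1) :^ 2 := a :* a :* (b :* b) :+ con 2 :* (a :* b) :+ con 1) refl
  a²+1<2a³ : a * a + 1 < 2 * (a * a * a)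
  a²+1<2a³ = begin-strict
    a * a + 1         <⟨ +-monoʳ-< (a * a) (≤-trans (s≤s (s≤s z≤n)) (*-mono-≤ 2≤a 2≤a)) ⟩
    a * a + a * a     ≡⟨ solve (a ∷ []) ⟩
    2 * (a * a) * 1   ≤⟨ *-monoʳ-≤ (2 * (a * a)) (≤-trans (s≤s z≤n) 2≤a) ⟩
    2 * (a * a) * a   ≡⟨ solve (a ∷ []) ⟩
    2 * (a * a * a)   ∎
  case-a²≤2b : (∃ λ R → a * a + R ≡ 2 * b) → ⊥
  case-a²≤2b (R , a²+R≡2b) = <⇒≱ a²+1<2a³ (2A+Rb²≡2kb+1⇒2A≤k²+1 {A = a * a * a} {R = R} {k = a} (+-cancelʳ-≡ (a * a * (b * b)) _ _ (begin-equality
    2 * (a * a * a) + R * (b * b) + a * a * (b * b) ≡⟨ solve (a ∷ b ∷ R ∷ []) ⟩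
    2 * (a * a * a) + b * b * (a * a + R)           ≡⟨ cong (λ t → 2 * (a * a * a) + b * b * t) a²+R≡2b ⟩
    2 * (a * a * a) + b * b * (2 * b)               ≡⟨ solve (a ∷ b ∷ []) ⟩
    2 * (a * a * a) + 2 * (b * b * b)               ≡⟨ expanded ⟩
    a * a * (b * b) + 2 * (a * b) + 1               ≡⟨ solve (a ∷ b ∷ []) ⟩
    2 * (a * b) + 1 + a * a * (b * b)               ∎)))
  case-2b<a² : (∃ λ R → 2 * b + suc R ≡ a * a) → ⊥
  case-2b<a² (R , 2b+R≡a²) = no-solution-below (λ a b → 2 * (a ^ 3 + b ^ 3)) (λ a b → (a * b + 1) ^ 2) 32 245 _ a<32 b<245 a<b eq
    where
    key : 2 * (a * a * a) ≡ suc R * (b * b) + 2 * (a * b) + 1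
    key = +-cancelʳ-≡ (2 * (b * b * b)) _ _ (begin-equality
      2 * (a * a * a) + 2 * (b * b * b)                       ≡⟨ expanded ⟩
      a * a * (b * b) + 2 * (a * b) + 1                       ≡⟨ cong (λ t → t * (b * b) + 2 * (a * b) + 1) 2b+R≡a² ⟨
      (2 * b + suc R) * (b * b) + 2 * (a * b) + 1             ≡⟨ solve (a ∷ b ∷ R ∷ []) ⟩
      suc R * (b * b) + 2 * (a * b) + 1 + 2 * (b * b * b)     ∎)
    b²<2a³ : b * b < 2 * (a * a * a)
    b²<2a³ = begin-strict
      b * b                              ≤⟨ m≤n*m (b * b) (suc R) ⟩
      suc R * (b * b)                    ≤⟨ m≤m+n _ _ ⟩
      suc R * (b * b) + 2 * (a * b)      <⟨ m<m+n _ z<s ⟩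
      suc R * (b * b) + 2 * (a * b) + 1  ≡⟨ key ⟨
      2 * (a * a * a)                    ∎
    a²<4b : a * a < 4 * b
    a²<4b = *-cancelʳ-< (b * b) (a * a) (4 * b) (begin-strict
      a * a * (b * b)                       <⟨ m<m+n _ z<s ⟩
      a * a * (b * b) + suc (2 * (a * b))   ≡⟨ solve (a ∷ b ∷ []) ⟩
      a * a * (b * b) + 2 * (a * b) + 1     ≡⟨ expanded ⟨
      2 * (a * a * a) + 2 * (b * b * b)     <⟨ +-monoˡ-< (2 * (b * b * b)) (*-monoʳ-< 2 (*-mono-< (*-mono-< a<b a<b) a<b)) ⟩
      2 * (b * b * b) + 2 * (b * b * b)     ≡⟨ solve (b ∷ []) ⟩
      4 * b * (b * b)                       ∎)
    a<32 : a < 32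
    a<32 = *-cancelʳ-< (a * a * a) a 32 (begin-strict
      a * (a * a * a)       ≡⟨ solve (a ∷ []) ⟩
      a * a * (a * a)       <⟨ *-mono-< a²<4b a²<4b ⟩
      4 * b * (4 * b)       ≡⟨ solve (b ∷ []) ⟩
      16 * (b * b)          <⟨ *-monoʳ-< 16 b²<2a³ ⟩
      16 * (2 * (a * a * a)) ≡⟨ solve (a ∷ []) ⟩
      32 * (a * a * a)      ∎)
    b<245 : b < 245
    b<245 = m*m<n*n⇒m<n b 245 (begin-strict
      b * b                      <⟨ b²<2a³ ⟩
      2 * (a * a * a)            ≤⟨ *-monoʳ-≤ 2 (*-mono-≤ (*-mono-≤ a≤31 a≤31) a≤31) ⟩
      2 * (31 * 31 * 31)         <⟨ from-yes (2 * (31 * 31 * 31) <? 245 * 245) ⟩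
      245 * 245                  ∎)
      where
      a≤31 : a ≤ 31
      a≤31 = ≤-pred a<32

-- As for (3, 2), with a⁴b² + 4a³b + 6a² ≈ 8b³ in place of a² ≈ 2b.
no-solution-5-4 : ∀ {a b} → 2 ≤ a → a < b → 8 * (a ^ 5 + b ^ 5) ≢ (a * b + 1) ^ 4
no-solution-5-4 {a} {b} 2≤a a<b eq =
  [ case-S≤8b³ , case-8b³<S ]′ (m+d≡n⊎n+1+d≡m (a * a * a * a * (b * b) + 4 * (a * a * a) * b + 6 * (a * a)) (8 * (b * b * b)))
  where
  open ≤-Reasoning
  expanded : 8 * (a * a * a * a * a) + 8 * (b * b * b * b * b)
           ≡ b * b * (a * a * a * a * (b * b) + 4 * (a * a * a) * b + 6 * (a * a)) + 4 * (a * b) + 1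
  expanded = trans (lhs a b) (trans eq (rhs a b))
    where
    lhs : ∀ a b → 8 * (a * a * a * a * a) + 8 * (b * b * b * b * b) ≡ 8 * (a ^ 5 + b ^ 5)
    lhs = +-*-Solver.solve 2 (λ a b → con 8 :* (a :* a :* a :* a :* a) :+ con 8 :* (b :* b :* b :* b :* b) :=
                                      con 8 :* (a :^ 5 :+ b :^ 5)) refl
    rhs : ∀ a b → (a * b + 1) ^ 4 ≡ b * b * (a * a * a * a * (b * b) + 4 * (a * a * a) * b + 6 * (a * a)) + 4 * (a * b) + 1
    rhs = +-*-Solver.solve 2 (λ a b → (a :* b :+ con 1) :^ 4 :=
      b :* b :* (a :* a :* a :* a :* (b :* b) :+ con 4 :* (a :* a :* a) :* b :+ con 6 :* (a :* a)) :+ con 4 :* (a :* b) :+ con 1) refl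
  1≤a : 1 ≤ a
  1≤a = ≤-trans (s≤s z≤n) 2≤a
  4a²+1<8a⁵ : 2 * a * (2 * a) + 1 < 2 * (4 * (a * a * a * a * a))
  4a²+1<8a⁵ = begin-strict
    2 * a * (2 * a) + 1           ≤⟨ +-monoʳ-≤ (2 * a * (2 * a)) (*-mono-≤ 1≤a 1≤a) ⟩
    2 * a * (2 * a) + a * a       ≡⟨ solve (a ∷ []) ⟩
    5 * (a * a)                   <⟨ *-monoˡ-< (a * a) {{>-nonZero (*-mono-≤ 1≤a 1≤a)}} (from-yes (5 <? 8)) ⟩
    8 * (a * a)                   ≡⟨ *-identityʳ (8 * (a * a)) ⟨
    8 * (a * a) * 1               ≤⟨ *-monoʳ-≤ (8 * (a * a)) (*-mono-≤ (*-mono-≤ 1≤a 1≤a) 1≤a) ⟩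
    8 * (a * a) * (a * a * a)     ≡⟨ solve (a ∷ []) ⟩
    2 * (4 * (a * a * a * a * a)) ∎
  case-S≤8b³ : (∃ λ R → a * a * a * a * (b * b) + 4 * (a * a * a) * b + 6 * (a * a) + R ≡ 8 * (b * b * b)) → ⊥
  case-S≤8b³ (R , S+R≡8b³) = <⇒≱ 4a²+1<8a⁵ (2A+Rb²≡2kb+1⇒2A≤k²+1 {A = 4 * (a * a * a * a * a)} {R = R} {k = 2 * a}
    (+-cancelʳ-≡ (b * b * (a * a * a * a * (b * b) + 4 * (a * a * a) * b + 6 * (a * a))) _ _ (begin-equality
      2 * (4 * (a * a * a * a * a)) + R * (b * b) + b * b * (a * a * a * a * (b * b) + 4 * (a * a * a) * b + 6 * (a * a))
        ≡⟨ solve (a ∷ b ∷ R ∷ []) ⟩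
      8 * (a * a * a * a * a) + b * b * (a * a * a * a * (b * b) + 4 * (a * a * a) * b + 6 * (a * a) + R)
        ≡⟨ cong (λ t → 8 * (a * a * a * a * a) + b * b * t) S+R≡8b³ ⟩
      8 * (a * a * a * a * a) + b * b * (8 * (b * b * b))
        ≡⟨ solve (a ∷ b ∷ []) ⟩
      8 * (a * a * a * a * a) + 8 * (b * b * b * b * b)
        ≡⟨ expanded ⟩
      b * b * (a * a * a * a * (b * b) + 4 * (a * a * a) * b + 6 * (a * a)) + 4 * (a * b) + 1
        ≡⟨ solve (a ∷ b ∷ []) ⟩
      2 * (2 * a * b) + 1 + b * b * (a * a * a * a * (b * b) + 4 * (a * a * a) * b + 6 * (a * a)) ∎)))
  case-8b³<S : (∃ λ R → 8 * (b * b * b) + suc R ≡ a * a * a * a * (b * b) + 4 * (a * a * a) * b + 6 * (a * a)) → ⊥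
  case-8b³<S (R , 8b³+R≡S) = no-solution-below (λ a b → 8 * (a ^ 5 + b ^ 5)) (λ a b → (a * b + 1) ^ 4) 13 1411 _ a<13 b<1411 a<b eq
    where
    key : 8 * (a * a * a * a * a) ≡ suc R * (b * b) + 4 * (a * b) + 1
    key = +-cancelʳ-≡ (8 * (b * b * b * b * b)) _ _ (begin-equality
      8 * (a * a * a * a * a) + 8 * (b * b * b * b * b)
        ≡⟨ expanded ⟩
      b * b * (a * a * a * a * (b * b) + 4 * (a * a * a) * b + 6 * (a * a)) + 4 * (a * b) + 1
        ≡⟨ cong (λ t → b * b * t + 4 * (a * b) + 1) 8b³+R≡S ⟨
      b * b * (8 * (b * b * b) + suc R) + 4 * (a * b) + 1
        ≡⟨ solve (a ∷ b ∷ R ∷ []) ⟩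
      suc R * (b * b) + 4 * (a * b) + 1 + 8 * (b * b * b * b * b) ∎)
    b²<8a⁵ : b * b < 8 * (a * a * a * a * a)
    b²<8a⁵ = begin-strict
      b * b                              ≤⟨ m≤n*m (b * b) (suc R) ⟩
      suc R * (b * b)                    ≤⟨ m≤m+n _ _ ⟩
      suc R * (b * b) + 4 * (a * b)      <⟨ m<m+n _ z<s ⟩
      suc R * (b * b) + 4 * (a * b) + 1  ≡⟨ key ⟨
      8 * (a * a * a * a * a)            ∎
    a⁵<b⁵ : a * a * a * a * a < b * b * b * b * b
    a⁵<b⁵ = *-mono-< (*-mono-< (*-mono-< (*-mono-< a<b a<b) a<b) a<b) a<b
    a⁴<16b : a * a * a * a < 16 * b
    a⁴<16b = *-cancelʳ-< (b * b * b * b) (a * a * a * a) (16 * b) (begin-strict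
      a * a * a * a * (b * b * b * b)
        <⟨ m<m+n _ z<s ⟩
      a * a * a * a * (b * b * b * b) + suc (4 * (a * a * a) * (b * b * b) + 6 * (a * a) * (b * b) + 4 * (a * b))
        ≡⟨ solve (a ∷ b ∷ []) ⟩
      b * b * (a * a * a * a * (b * b) + 4 * (a * a * a) * b + 6 * (a * a)) + 4 * (a * b) + 1
        ≡⟨ expanded ⟨
      8 * (a * a * a * a * a) + 8 * (b * b * b * b * b)
        <⟨ +-monoˡ-< (8 * (b * b * b * b * b)) (*-monoʳ-< 8 a⁵<b⁵) ⟩
      8 * (b * b * b * b * b) + 8 * (b * b * b * b * b)
        ≡⟨ solve (b ∷ []) ⟩
      16 * b * (b * b * b * b) ∎)
    a³<2048 : a * a * a < 2048
    a³<2048 = *-cancelʳ-< (a * a * a * a * a) (a * a * a) 2048 (begin-strict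
      a * a * a * (a * a * a * a * a)   ≡⟨ solve (a ∷ []) ⟩
      a * a * a * a * (a * a * a * a)   <⟨ *-mono-< a⁴<16b a⁴<16b ⟩
      16 * b * (16 * b)                 ≡⟨ solve (b ∷ []) ⟩
      256 * (b * b)                     <⟨ *-monoʳ-< 256 b²<8a⁵ ⟩
      256 * (8 * (a * a * a * a * a))   ≡⟨ solve (a ∷ []) ⟩
      2048 * (a * a * a * a * a)        ∎)
    a<13 : a < 13
    a<13 = m*m*m<n*n*n⇒m<n a 13 (<-trans a³<2048 (from-yes (2048 <? 13 * 13 * 13)))
    b<1411 : b < 1411
    b<1411 = m*m<n*n⇒m<n b 1411 (begin-strict
      b * b                         <⟨ b²<8a⁵ ⟩
      8 * (a * a * a * a * a)       ≤⟨ *-monoʳ-≤ 8 (*-mono-≤ (*-mono-≤ (*-mono-≤ (*-mono-≤ a≤12 a≤12) a≤12) a≤12) a≤12) ⟩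
      8 * (12 * 12 * 12 * 12 * 12)  <⟨ from-yes (8 * (12 * 12 * 12 * 12 * 12) <? 1411 * 1411) ⟩
      1411 * 1411                   ∎)
      where
      a≤12 : a ≤ 12
      a≤12 = ≤-pred a<13

-- The exponent pair (5, 3)

-- ⌊√ n⌋ by bisection. Nothing is proved about it (Window.Cleared re-checks its output); it is
-- opaque because unfolding it on a symbolic argument makes the type checker explode.
opaque
  isqrt : ℕ → ℕ
  isqrt n = bisect 40 0 (suc n)
    where
    bisect : ℕ → ℕ → ℕ → ℕ
    bisect zero       lo hi = lo
    bisect (suc fuel) lo hi =
      let mid = (lo + hi) / 2 in
      if mid * mid ≤ᵇ n then bisect fuel mid hi else bisect fuel lo mid

Solution-5-3 : ℕ → ℕ → Set
Solution-5-3 a b = 4 * (a ^ 5 + b ^ 5) ≡ (a * b + 1) ^ 3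

-- b must satisfy a³ − 26a < 4b² < a³; lo and hi bracket the possible values of b.
module Window (a : ℕ) where
  lo hi : ℕ
  lo = isqrt ((a * a * a ∸ 26 * a) / 4)
  hi = isqrt (a * a * a / 4)

  Cleared : Set
  Cleared = 4 * (lo * lo) + 26 * a ≤ a * a * a × a * a * a ≤ 4 * (suc hi * suc hi) ×
            (∀ {i} → i < suc hi ∸ lo → ¬ Solution-5-3 a (lo + i))

  cleared? : Dec Cleared
  cleared? = (4 * (lo * lo) + 26 * a ≤? a * a * a) ×-dec (a * a * a ≤? 4 * (suc hi * suc hi)) ×-dec
             allUpTo? (λ i → ¬? (4 * (a ^ 5 + (lo + i) ^ 5) ≟ (a * (lo + i) + 1) ^ 3)) (suc hi ∸ lo)

opaque
  unfolding isqrt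
  windows-cleared : ∀ {a} → a < 8000 → 8 ≤ a → Window.Cleared a
  windows-cleared = toWitness {a? = allUpTo? (λ a → 8 ≤? a →-dec Window.cleared? a) 8000} _

no-solution-in-window : ∀ {a b} → 8 ≤ a → a < 8000 → a * a * a < 4 * (b * b) + 26 * a → 4 * (b * b) < a * a * a →
                        ¬ Solution-5-3 a b
no-solution-in-window {a} {b} 8≤a a<8000 above below with windows-cleared a<8000 8≤a
... | 4lo²+26a≤a³ , a³≤4[1+hi]² , cleared = subst (¬_ ∘ Solution-5-3 a) (m+[n∸m]≡n (<⇒≤ lo<b)) (cleared (∸-monoˡ-< b<1+hi (<⇒≤ lo<b)))
  where
  open Window a
  lo<b : lo < b
  lo<b = m*m<n*n⇒m<n lo b (*-cancelˡ-< 4 _ _ (+-cancelʳ-< (26 * a) _ _ (≤-<-trans 4lo²+26a≤a³ above)))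
  b<1+hi : b < suc hi
  b<1+hi = m*m<n*n⇒m<n b (suc hi) (*-cancelˡ-< 4 _ _ (<-≤-trans below a³≤4[1+hi]²))

-- Otherwise a³ ≤ b², and the surplus 4b⁵ − a³b³ ≥ 3b⁵ would exceed the lower terms of (ab + 1)³.
4b²<a³ : ∀ {a b} → 2 ≤ a → a < b →
         4 * (a * a * a * a * a) + 4 * (b * b * b * b * b) ≡ a * a * a * (b * b * b) + 3 * (a * a * (b * b)) + 3 * (a * b) + 1 →
         4 * (b * b) < a * a * a
4b²<a³ {a} {b} 2≤a a<b expanded = ≰⇒> λ a³≤4b² → let U , a³+U≡4b² = m≤n⇒∃[o]m+o≡n a³≤4b² in impossible U a³+U≡4b²
  where
  open ≤-Reasoning
  2≤b : 2 ≤ b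
  2≤b = ≤-trans 2≤a (<⇒≤ a<b)
  impossible : ∀ U → a * a * a + U ≡ 4 * (b * b) → ⊥
  impossible U a³+U≡4b² = <⇒≱ 3b<4 (≤-trans (s≤s (s≤s (s≤s (s≤s z≤n)))) (*-monoʳ-≤ 3 2≤b))
    where
    key : 4 * (a * a * a * a * a) + U * (b * b * b) ≡ 3 * (a * a * (b * b)) + 3 * (a * b) + 1
    key = +-cancelʳ-≡ (a * a * a * (b * b * b)) _ _ (begin-equality
      4 * (a * a * a * a * a) + U * (b * b * b) + a * a * a * (b * b * b) ≡⟨ solve (a ∷ b ∷ U ∷ []) ⟩
      4 * (a * a * a * a * a) + (a * a * a + U) * (b * b * b)           ≡⟨ cong (λ t → 4 * (a * a * a * a * a) + t * (b * b * b)) a³+U≡4b² ⟩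
      4 * (a * a * a * a * a) + 4 * (b * b) * (b * b * b)               ≡⟨ solve (a ∷ b ∷ []) ⟩
      4 * (a * a * a * a * a) + 4 * (b * b * b * b * b)                 ≡⟨ expanded ⟩
      a * a * a * (b * b * b) + 3 * (a * a * (b * b)) + 3 * (a * b) + 1 ≡⟨ solve (a ∷ b ∷ []) ⟩
      3 * (a * a * (b * b)) + 3 * (a * b) + 1 + a * a * a * (b * b * b) ∎)
    bound : 4 * (a * a * a * a * a) + U * (b * b * b) ≤ 4 * (a * a) * (b * b)
    bound = begin
      4 * (a * a * a * a * a) + U * (b * b * b) ≡⟨ key ⟩
      3 * (a * a * (b * b)) + 3 * (a * b) + 1   ≡⟨ solve (a ∷ b ∷ []) ⟩
      3 * (a * b * (a * b)) + (3 * (a * b) + 1) ≤⟨ +-monoʳ-≤ (3 * (a * b * (a * b))) (3x+1≤x² (*-mono-≤ 2≤a 2≤b)) ⟩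
      3 * (a * b * (a * b)) + a * b * (a * b)   ≡⟨ solve (a ∷ b ∷ []) ⟩
      4 * (a * a) * (b * b)                     ∎
    a³≤b² : a * a * a ≤ b * b
    a³≤b² = *-cancelˡ-≤ (4 * (a * a)) {{>-nonZero (≤-trans (s≤s z≤n) (*-monoʳ-≤ 4 (*-mono-≤ 2≤a 2≤a)))}} (begin
      4 * (a * a) * (a * a * a)                 ≡⟨ solve (a ∷ []) ⟩
      4 * (a * a * a * a * a)                   ≤⟨ m≤m+n _ _ ⟩
      4 * (a * a * a * a * a) + U * (b * b * b) ≤⟨ bound ⟩
      4 * (a * a) * (b * b)                     ∎)
    3b²≤U : 3 * (b * b) ≤ U
    3b²≤U = +-cancelˡ-≤ (b * b) _ _ (begin
      b * b + 3 * (b * b) ≡⟨ solve (b ∷ []) ⟩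
      4 * (b * b)         ≡⟨ a³+U≡4b² ⟨
      a * a * a + U       ≤⟨ +-monoˡ-≤ U a³≤b² ⟩
      b * b + U           ∎)
    3b<4 : 3 * b < 4
    3b<4 = *-cancelˡ-< (b * b * b * b) (3 * b) 4 (begin-strict
      b * b * b * b * (3 * b)                   ≡⟨ solve (b ∷ []) ⟩
      3 * (b * b) * (b * b * b)                 ≤⟨ *-monoˡ-≤ (b * b * b) 3b²≤U ⟩
      U * (b * b * b)                           ≤⟨ m≤n+m _ _ ⟩
      4 * (a * a * a * a * a) + U * (b * b * b) ≤⟨ bound ⟩
      4 * (a * a) * (b * b)                     <⟨ *-monoˡ-< (b * b) {{>-nonZero (≤-trans (s≤s z≤n) (*-mono-≤ 2≤b 2≤b))}} (*-monoʳ-< 4 (*-mono-< a<b a<b)) ⟩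
      4 * (b * b) * (b * b)                     ≡⟨ solve (b ∷ []) ⟩
      b * b * b * b * 4                         ∎)

-- With a³ = 4b² + T, comparing a²-coefficients forces Tb > 13a²; otherwise b² ≥ 12a³ > 4b².
13a²<Tb : ∀ {a b T} → 2 ≤ a → a < b → 4 * (b * b) + T ≡ a * a * a →
          13 * (a * a * (b * b)) + 4 * (a * a) * T ≡ T * (b * b * b) + 3 * (a * b) + 1 →
          13 * (a * a) < T * b
13a²<Tb {a} {b} {T} 2≤a a<b 4b²+T≡a³ eq = ≰⇒> λ Tb≤13a² → <⇒≱ (from-yes (1 <? 48)) (48≤1 Tb≤13a²)
  where
  open ≤-Reasoning
  2≤b : 2 ≤ b
  2≤b = ≤-trans 2≤a (<⇒≤ a<b)
  4≤ab : 4 ≤ a * b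
  4≤ab = *-mono-≤ 2≤a 2≤b
  48≤1 : T * b ≤ 13 * (a * a) → 48 ≤ 1
  48≤1 Tb≤13a² = *-cancelʳ-≤ 48 1 (a * a * a) {{>-nonZero (*-mono-≤ (*-mono-≤ 1≤a 1≤a) 1≤a)}} (begin
    48 * (a * a * a)      ≡⟨ solve (a ∷ []) ⟩
    4 * (12 * (a * a * a)) ≤⟨ *-monoʳ-≤ 4 12a³≤b² ⟩
    4 * (b * b)           ≤⟨ m≤m+n (4 * (b * b)) T ⟩
    4 * (b * b) + T       ≡⟨ 4b²+T≡a³ ⟩
    a * a * a             ≡⟨ *-identityˡ (a * a * a) ⟨
    1 * (a * a * a)       ∎)
    where
    1≤a : 1 ≤ a
    1≤a = ≤-trans (s≤s z≤n) 2≤a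
    Tb³≤13a²b² : T * (b * b * b) ≤ 13 * (a * a * (b * b))
    Tb³≤13a²b² = begin
      T * (b * b * b)        ≡⟨ solve (T ∷ b ∷ []) ⟩
      T * b * (b * b)        ≤⟨ *-monoˡ-≤ (b * b) Tb≤13a² ⟩
      13 * (a * a) * (b * b) ≡⟨ solve (a ∷ b ∷ []) ⟩
      13 * (a * a * (b * b)) ∎
    4a²T≤3ab+1 : 4 * (a * a) * T ≤ 3 * (a * b) + 1
    4a²T≤3ab+1 = +-cancelˡ-≤ (13 * (a * a * (b * b))) _ _ (begin
      13 * (a * a * (b * b)) + 4 * (a * a) * T    ≡⟨ eq ⟩
      T * (b * b * b) + 3 * (a * b) + 1           ≡⟨ +-assoc (T * (b * b * b)) (3 * (a * b)) 1 ⟩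
      T * (b * b * b) + (3 * (a * b) + 1)         ≤⟨ +-monoˡ-≤ (3 * (a * b) + 1) Tb³≤13a²b² ⟩
      13 * (a * a * (b * b)) + (3 * (a * b) + 1)  ∎)
    12a²≤Tb : 12 * (a * a) ≤ T * b
    12a²≤Tb = *-cancelʳ-≤ (12 * (a * a)) (T * b) (b * b) {{>-nonZero (≤-trans (s≤s z≤n) (*-mono-≤ 2≤b 2≤b))}}
      (+-cancelʳ-≤ (a * a * (b * b)) _ _ (begin
        12 * (a * a) * (b * b) + a * a * (b * b)   ≡⟨ solve (a ∷ b ∷ []) ⟩
        13 * (a * a * (b * b))                     ≤⟨ m≤m+n _ _ ⟩
        13 * (a * a * (b * b)) + 4 * (a * a) * T   ≡⟨ eq ⟩
        T * (b * b * b) + 3 * (a * b) + 1          ≡⟨ solve (a ∷ b ∷ T ∷ []) ⟩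
        T * b * (b * b) + (3 * (a * b) + 1)        ≤⟨ +-monoʳ-≤ (T * b * (b * b)) (3x+1≤x² 4≤ab) ⟩
        T * b * (b * b) + a * b * (a * b)          ≡⟨ solve (a ∷ b ∷ T ∷ []) ⟩
        T * b * (b * b) + a * a * (b * b)          ∎))
    12a³≤b² : 12 * (a * a * a) ≤ b * b
    12a³≤b² = *-cancelˡ-≤ (4 * a) {{>-nonZero (≤-trans (s≤s z≤n) (*-monoʳ-≤ 4 1≤a))}} (begin
      4 * a * (12 * (a * a * a))   ≡⟨ solve (a ∷ []) ⟩
      4 * (a * a) * (12 * (a * a)) ≤⟨ *-monoʳ-≤ (4 * (a * a)) 12a²≤Tb ⟩
      4 * (a * a) * (T * b)        ≡⟨ solve (a ∷ b ∷ T ∷ []) ⟩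
      4 * (a * a) * T * b          ≤⟨ *-monoˡ-≤ b 4a²T≤3ab+1 ⟩
      (3 * (a * b) + 1) * b        ≤⟨ *-monoˡ-≤ b (+-monoʳ-≤ (3 * (a * b)) (*-mono-≤ 1≤a (≤-trans (s≤s z≤n) 2≤b))) ⟩
      (3 * (a * b) + a * b) * b    ≡⟨ solve (a ∷ b ∷ []) ⟩
      4 * a * (b * b)              ∎)

-- From here on a³ = 4b² + T and Tb = 13a² + M; these pin b down to a narrow window once a ≥ 8.
module Large-a {a b T M : ℕ} (8≤a : 8 ≤ a) (a<b : a < b) (1≤M : 1 ≤ M)
               (4b²+T≡a³ : 4 * (b * b) + T ≡ a * a * a) (13a²+M≡Tb : 13 * (a * a) + M ≡ T * b)
               (Mb²+3ab+1≡4a²T : M * (b * b) + 3 * (a * b) + 1 ≡ 4 * (a * a) * T) where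

  open ≤-Reasoning

  1≤a : 1 ≤ a
  1≤a = ≤-trans (s≤s z≤n) 8≤a

  Mb²<4a²T : M * (b * b) < 4 * (a * a) * T
  Mb²<4a²T = begin-strict
    M * (b * b)                     ≤⟨ m≤m+n _ (3 * (a * b)) ⟩
    M * (b * b) + 3 * (a * b)       <⟨ m<m+n _ z<s ⟩
    M * (b * b) + 3 * (a * b) + 1   ≡⟨ Mb²+3ab+1≡4a²T ⟩
    4 * (a * a) * T                 ∎

  M<13a² : M < 13 * (a * a)
  M<13a² = ≰⇒> λ 13a²≤M → <⇒≱ (b³<8a² 13a²≤M) 8a²≤b³
    where
    8a²≤b³ : 8 * (a * a) ≤ b * b * b
    8a²≤b³ = begin
      8 * (a * a) ≡⟨ solve (a ∷ []) ⟩
      8 * a * a   ≤⟨ *-mono-≤ (*-mono-≤ (≤-trans 8≤a (<⇒≤ a<b)) (<⇒≤ a<b)) (<⇒≤ a<b) ⟩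
      b * b * b   ∎
    b³<8a² : 13 * (a * a) ≤ M → b * b * b < 8 * (a * a)
    b³<8a² 13a²≤M = *-cancelˡ-< T _ _ (begin-strict
      T * (b * b * b)         ≡⟨ solve (T ∷ b ∷ []) ⟩
      T * b * (b * b)         ≡⟨ cong (_* (b * b)) 13a²+M≡Tb ⟨
      (13 * (a * a) + M) * (b * b) ≤⟨ *-monoˡ-≤ (b * b) (+-monoˡ-≤ M 13a²≤M) ⟩
      (M + M) * (b * b)       ≡⟨ solve (M ∷ b ∷ []) ⟩
      2 * (M * (b * b))       <⟨ *-monoʳ-< 2 Mb²<4a²T ⟩
      2 * (4 * (a * a) * T)   ≡⟨ solve (a ∷ T ∷ []) ⟩
      T * (8 * (a * a))       ∎)

  T<26a : T < 26 * a
  T<26a = *-cancelʳ-< a T (26 * a) (begin-strict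
    T * a             ≤⟨ *-monoʳ-≤ T (<⇒≤ a<b) ⟩
    T * b             ≡⟨ 13a²+M≡Tb ⟨
    13 * (a * a) + M  <⟨ +-monoʳ-< (13 * (a * a)) M<13a² ⟩
    13 * (a * a) + 13 * (a * a) ≡⟨ solve (a ∷ []) ⟩
    26 * a * a        ∎)

  M≤13a² : M ≤ 13 * (a * a)
  M≤13a² = <⇒≤ M<13a²

  13a²≤Tb : 13 * (a * a) ≤ T * b
  13a²≤Tb = subst (13 * (a * a) ≤_) 13a²+M≡Tb (m≤m+n _ M)

  a³-nonZero : NonZero (a * a * a)
  a³-nonZero = >-nonZero (*-mono-≤ (*-mono-≤ 1≤a 1≤a) 1≤a)

  a³T²≡ : a * a * a * (T * T) ≡ 676 * (a * a * a * a) + 104 * (a * a) * M + 4 * (M * M) + T * T * T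
  a³T²≡ = begin-equality
    a * a * a * (T * T)                                       ≡⟨ cong (_* (T * T)) 4b²+T≡a³ ⟨
    (4 * (b * b) + T) * (T * T)                               ≡⟨ solve (b ∷ T ∷ []) ⟩
    4 * (T * b * (T * b)) + T * T * T                         ≡⟨ cong (λ t → 4 * (t * t) + T * T * T) 13a²+M≡Tb ⟨
    4 * ((13 * (a * a) + M) * (13 * (a * a) + M)) + T * T * T ≡⟨ solve (a ∷ M ∷ T ∷ []) ⟩
    676 * (a * a * a * a) + 104 * (a * a) * M + 4 * (M * M) + T * T * T ∎

  169a²M≤4T³ : 169 * (a * a) * M ≤ 4 * (T * T * T)
  169a²M≤4T³ = *-cancelˡ-≤ (a * a) {{>-nonZero (*-mono-≤ 1≤a 1≤a)}} (begin
    a * a * (169 * (a * a) * M)             ≡⟨ solve (a ∷ M ∷ []) ⟩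
    M * (13 * (a * a)) * (13 * (a * a))     ≤⟨ *-mono-≤ (*-monoʳ-≤ M 13a²≤Tb) 13a²≤Tb ⟩
    M * (T * b) * (T * b)                   ≡⟨ solve (M ∷ T ∷ b ∷ []) ⟩
    M * (b * b) * (T * T)                   ≤⟨ *-monoˡ-≤ (T * T) (<⇒≤ Mb²<4a²T) ⟩
    4 * (a * a) * T * (T * T)               ≡⟨ solve (a ∷ T ∷ []) ⟩
    a * a * (4 * (T * T * T))               ∎)

  676a<T² : 676 * a < T * T
  676a<T² = *-cancelˡ-< (a * a * a) _ _ (begin-strict
    a * a * a * (676 * a)                                         ≡⟨ solve (a ∷ []) ⟩
    676 * (a * a * a * a)                                         <⟨ m<m+n _ (*-mono-≤ (*-mono-≤ (s≤s {0} {103} z≤n) (*-mono-≤ 1≤a 1≤a)) 1≤M) ⟩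
    676 * (a * a * a * a) + 104 * (a * a) * M                     ≤⟨ m≤m+n _ _ ⟩
    676 * (a * a * a * a) + 104 * (a * a) * M + 4 * (M * M)       ≤⟨ m≤m+n _ _ ⟩
    676 * (a * a * a * a) + 104 * (a * a) * M + 4 * (M * M) + T * T * T ≡⟨ a³T²≡ ⟨
    a * a * a * (T * T)                                           ∎)

  T²<2704a+17576 : T * T < 2704 * a + 17576
  T²<2704a+17576 = *-cancelˡ-< (a * a * a) _ _ (begin-strict
    a * a * a * (T * T)
      ≡⟨ a³T²≡ ⟩
    676 * (a * a * a * a) + 104 * (a * a) * M + 4 * (M * M) + T * T * T
      <⟨ +-mono-≤-< (+-mono-≤ (+-monoʳ-≤ (676 * (a * a * a * a)) (*-monoʳ-≤ (104 * (a * a)) M≤13a²))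
                              (*-monoʳ-≤ 4 (*-mono-≤ M≤13a² M≤13a²)))
                    (*-mono-< (*-mono-< T<26a T<26a) T<26a) ⟩
    676 * (a * a * a * a) + 104 * (a * a) * (13 * (a * a)) + 4 * (13 * (a * a) * (13 * (a * a))) + 26 * a * (26 * a) * (26 * a)
      ≡⟨ solve (a ∷ []) ⟩
    a * a * a * (2704 * a + 17576) ∎)

  169a³≤793T³ : 169 * (a * a * a) ≤ 793 * (T * T * T)
  169a³≤793T³ = using-excess (<⇒∃+suc 676a<T²)
    where
    13M²≤4T³ : 13 * M * M ≤ 4 * (T * T * T)
    13M²≤4T³ = begin
      13 * M * M              ≤⟨ *-monoʳ-≤ (13 * M) M≤13a² ⟩
      13 * M * (13 * (a * a)) ≡⟨ solve (a ∷ M ∷ []) ⟩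
      169 * (a * a) * M       ≤⟨ 169a²M≤4T³ ⟩
      4 * (T * T * T)         ∎
    using-excess : (∃ λ e → 676 * a + suc e ≡ T * T) → 169 * (a * a * a) ≤ 793 * (T * T * T)
    using-excess (e , 676a+e≡T²) = begin
      169 * (a * a * a)                                      ≤⟨ m≤m*n (169 * (a * a * a)) (suc e) ⟩
      169 * (a * a * a) * suc e                              ≡⟨ solve (a ∷ e ∷ []) ⟩
      169 * (a * a * a * suc e)                              ≡⟨ cong (169 *_) a³e≡ ⟩
      169 * (104 * (a * a) * M + 4 * (M * M) + T * T * T)    ≡⟨ solve (a ∷ M ∷ T ∷ []) ⟩
      104 * (169 * (a * a) * M) + 52 * (13 * M * M) + 169 * (T * T * T)
        ≤⟨ +-monoˡ-≤ (169 * (T * T * T)) (+-mono-≤ (*-monoʳ-≤ 104 169a²M≤4T³) (*-monoʳ-≤ 52 13M²≤4T³)) ⟩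
      104 * (4 * (T * T * T)) + 52 * (4 * (T * T * T)) + 169 * (T * T * T) ≡⟨ solve (T ∷ []) ⟩
      793 * (T * T * T)                                      ∎
      where
      a³e≡ : a * a * a * suc e ≡ 104 * (a * a) * M + 4 * (M * M) + T * T * T
      a³e≡ = +-cancelˡ-≡ (676 * (a * a * a * a)) _ _ (begin-equality
        676 * (a * a * a * a) + a * a * a * suc e                     ≡⟨ solve (a ∷ e ∷ []) ⟩
        a * a * a * (676 * a + suc e)                                 ≡⟨ cong (a * a * a *_) 676a+e≡T² ⟩
        a * a * a * (T * T)                                           ≡⟨ a³T²≡ ⟩
        676 * (a * a * a * a) + 104 * (a * a) * M + 4 * (M * M) + T * T * T ≡⟨ solve (a ∷ M ∷ T ∷ []) ⟩
        676 * (a * a * a * a) + (104 * (a * a) * M + 4 * (M * M) + T * T * T) ∎)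

  a<8000 : a < 8000
  a<8000 = ≰⇒> λ 8000≤a → <⇒≱ (from-yes (12474155166273307 <? 28561 * (8000 * 8000 * 8000))) (begin
    28561 * (8000 * 8000 * 8000) ≤⟨ *-monoʳ-≤ 28561 (*-mono-≤ (*-mono-≤ 8000≤a 8000≤a) 8000≤a) ⟩
    28561 * (a * a * a)          ≤⟨ a³-bound 8000≤a ⟩
    12474155166273307            ∎)
    where
    a³-bound : 8000 ≤ a → 28561 * (a * a * a) ≤ 12474155166273307
    a³-bound 8000≤a = *-cancelʳ-≤ _ _ (a * a * a) {{a³-nonZero}} (begin
      28561 * (a * a * a) * (a * a * a)                 ≡⟨ *-assoc 28561 (a * a * a) (a * a * a) ⟩
      28561 * (a * a * a * (a * a * a))                 ≡⟨ interchange 169 (a * a * a) 169 (a * a * a) ⟨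
      169 * (a * a * a) * (169 * (a * a * a))           ≤⟨ *-mono-≤ 169a³≤793T³ 169a³≤793T³ ⟩
      793 * (T * T * T) * (793 * (T * T * T))           ≡⟨ interchange 793 (T * T * T) 793 (T * T * T) ⟩
      628849 * (T * T * T * (T * T * T))                ≡⟨ cong (628849 *_) T³T³≡ ⟩
      628849 * (T * T * (T * T) * (T * T))              ≤⟨ *-monoʳ-≤ 628849 (*-mono-≤ (*-mono-≤ T²≤2707a T²≤2707a) T²≤2707a) ⟩
      628849 * (2707 * a * (2707 * a) * (2707 * a))     ≡⟨ cong (628849 *_) [2707a]³≡ ⟩
      628849 * (19836487243 * (a * a * a))              ≡⟨ *-assoc 628849 19836487243 (a * a * a) ⟨
      12474155166273307 * (a * a * a)                   ∎)
      where
      T³T³≡ : T * T * T * (T * T * T) ≡ T * T * (T * T) * (T * T)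
      T³T³≡ = solve (T ∷ [])
      [2707a]³≡ : 2707 * a * (2707 * a) * (2707 * a) ≡ 19836487243 * (a * a * a)
      [2707a]³≡ = trans (cong (_* (2707 * a)) (interchange 2707 a 2707 a)) (interchange (2707 * 2707) (a * a) 2707 a)
      T²≤2707a : T * T ≤ 2707 * a
      T²≤2707a = begin
        T * T              ≤⟨ <⇒≤ T²<2704a+17576 ⟩
        2704 * a + 17576   ≤⟨ +-monoʳ-≤ (2704 * a) (≤-trans (from-yes (17576 ≤? 3 * 8000)) (*-monoʳ-≤ 3 8000≤a)) ⟩
        2704 * a + 3 * a   ≡⟨ solve (a ∷ []) ⟩
        2707 * a           ∎

no-solution-5-3 : ∀ {a b} → 2 ≤ a → a < b → 4 * (a ^ 5 + b ^ 5) ≢ (a * b + 1) ^ 3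
no-solution-5-3 {a} {b} 2≤a a<b eq = given-T (m≤n⇒∃[o]m+o≡n (<⇒≤ 4b²<a³′))
  where
  open ≤-Reasoning
  expanded : 4 * (a * a * a * a * a) + 4 * (b * b * b * b * b) ≡ a * a * a * (b * b * b) + 3 * (a * a * (b * b)) + 3 * (a * b) + 1
  expanded = trans (lhs a b) (trans eq (rhs a b))
    where
    lhs : ∀ a b → 4 * (a * a * a * a * a) + 4 * (b * b * b * b * b) ≡ 4 * (a ^ 5 + b ^ 5)
    lhs = +-*-Solver.solve 2 (λ a b → con 4 :* (a :* a :* a :* a :* a) :+ con 4 :* (b :* b :* b :* b :* b) :=
                                      con 4 :* (a :^ 5 :+ b :^ 5)) refl
    rhs : ∀ a b → (a * b + 1) ^ 3 ≡ a * a * a * (b * b * b) + 3 * (a * a * (b * b)) + 3 * (a * b) + 1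
    rhs = +-*-Solver.solve 2 (λ a b → (a :* b :+ con 1) :^ 3 :=
                                      a :* a :* a :* (b :* b :* b) :+ con 3 :* (a :* a :* (b :* b)) :+ con 3 :* (a :* b) :+ con 1) refl
  4b²<a³′ : 4 * (b * b) < a * a * a
  4b²<a³′ = 4b²<a³ 2≤a a<b expanded
  given-T : (∃ λ T → 4 * (b * b) + T ≡ a * a * a) → ⊥
  given-T (T , 4b²+T≡a³) = given-M (<⇒∃+suc (13a²<Tb 2≤a a<b 4b²+T≡a³ a²-coefficients))
    where
    a²-coefficients : 13 * (a * a * (b * b)) + 4 * (a * a) * T ≡ T * (b * b * b) + 3 * (a * b) + 1
    a²-coefficients = +-cancelʳ-≡ (3 * (a * a * (b * b)) + 4 * (b * b * b * b * b)) _ _ (begin-equality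
      13 * (a * a * (b * b)) + 4 * (a * a) * T + (3 * (a * a * (b * b)) + 4 * (b * b * b * b * b))
        ≡⟨ solve (a ∷ b ∷ T ∷ []) ⟩
      4 * (a * a) * (4 * (b * b) + T) + 4 * (b * b * b * b * b)
        ≡⟨ cong (λ t → 4 * (a * a) * t + 4 * (b * b * b * b * b)) 4b²+T≡a³ ⟩
      4 * (a * a) * (a * a * a) + 4 * (b * b * b * b * b)
        ≡⟨ solve (a ∷ b ∷ []) ⟩
      4 * (a * a * a * a * a) + 4 * (b * b * b * b * b)
        ≡⟨ expanded ⟩
      a * a * a * (b * b * b) + 3 * (a * a * (b * b)) + 3 * (a * b) + 1
        ≡⟨ cong (λ t → t * (b * b * b) + 3 * (a * a * (b * b)) + 3 * (a * b) + 1) 4b²+T≡a³ ⟨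
      (4 * (b * b) + T) * (b * b * b) + 3 * (a * a * (b * b)) + 3 * (a * b) + 1
        ≡⟨ solve (a ∷ b ∷ T ∷ []) ⟩
      T * (b * b * b) + 3 * (a * b) + 1 + (3 * (a * a * (b * b)) + 4 * (b * b * b * b * b)) ∎)
    given-M : (∃ λ M′ → 13 * (a * a) + suc M′ ≡ T * b) → ⊥
    given-M (M′ , 13a²+M≡Tb) = [ case-a<8 , case-8≤a ]′ (<-≤-connex a 8)
      where
      b²-coefficients : suc M′ * (b * b) + 3 * (a * b) + 1 ≡ 4 * (a * a) * T
      b²-coefficients = +-cancelˡ-≡ (13 * (a * a * (b * b))) _ _ (begin-equality
        13 * (a * a * (b * b)) + (suc M′ * (b * b) + 3 * (a * b) + 1) ≡⟨ solve (a ∷ b ∷ M′ ∷ []) ⟩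
        (13 * (a * a) + suc M′) * (b * b) + 3 * (a * b) + 1          ≡⟨ cong (λ t → t * (b * b) + 3 * (a * b) + 1) 13a²+M≡Tb ⟩
        T * b * (b * b) + 3 * (a * b) + 1                            ≡⟨ solve (a ∷ b ∷ T ∷ []) ⟩
        T * (b * b * b) + 3 * (a * b) + 1                            ≡⟨ a²-coefficients ⟨
        13 * (a * a * (b * b)) + 4 * (a * a) * T                     ∎)
      case-a<8 : a < 8 → ⊥
      case-a<8 a<8 = no-solution-below (λ a b → 4 * (a ^ 5 + b ^ 5)) (λ a b → (a * b + 1) ^ 3) 8 10 _ a<8 b<10 a<b eq
        where
        a≤7 : a ≤ 7
        a≤7 = ≤-pred a<8
        b<10 : b < 10
        b<10 = m*m<n*n⇒m<n b 10 (*-cancelˡ-< 4 _ _ (begin-strict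
          4 * (b * b)     <⟨ 4b²<a³′ ⟩
          a * a * a       ≤⟨ *-mono-≤ (*-mono-≤ a≤7 a≤7) a≤7 ⟩
          7 * 7 * 7       ≤⟨ from-yes (7 * 7 * 7 ≤? 4 * (10 * 10)) ⟩
          4 * (10 * 10)   ∎))
      case-8≤a : 8 ≤ a → ⊥
      case-8≤a 8≤a = no-solution-in-window 8≤a a<8000 a³<4b²+26a 4b²<a³′ eq
        where
        open Large-a 8≤a a<b (s≤s z≤n) 4b²+T≡a³ 13a²+M≡Tb b²-coefficients using (T<26a; a<8000)
        a³<4b²+26a : a * a * a < 4 * (b * b) + 26 * a
        a³<4b²+26a = subst (_< 4 * (b * b) + 26 * a) 4b²+T≡a³ (+-monoʳ-< (4 * (b * b)) T<26a)

small-w-excluded : ∀ y w k → 2 * suc w ≤ y → 2 ≤ a → a < b → a * b + 1 ≡ 2 * k → a ^ y + b ^ y ≢ 2 * k ^ suc w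
small-w-excluded y w k 2w≤y 2≤a a<b ab+1≡2k sum≡ = <⇒≢ (2kʷ<sum-of-powers y w k 2w≤y (<⇒≤ 2≤a) a<b ab+1≡2k) (sym sum≡)

large-w-excluded : ∀ y w k → 1 ≤ y → y ≤ suc w → 2 ≤ a → a < b → a * b + 1 ≡ 2 * k → a ^ y + b ^ y ≢ 2 * k ^ suc w
large-w-excluded y w k 1≤y y≤w 2≤a a<b ab+1≡2k = <⇒≢ (sum-of-powers<2kʷ y (suc w) k 1≤y y≤w 2≤a a<b ab+1≡2k)

-- The exponent W = w + 1 of k is excluded by size alone if 2W ≤ y or W ≥ y; this leaves (y, W) = (3, 2), (5, 3), (5, 4).
no-solution-2≤a : ∀ {y a b k w} → y ≡ 3 ⊎ y ≡ 5 → 2 ≤ a → a < b → a * b + 1 ≡ 2 * k → a ^ y + b ^ y ≢ 2 * k ^ suc w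
no-solution-2≤a {k = k} {0}           (inj₁ refl) = small-w-excluded 3 0 k (s≤s (s≤s z≤n))
no-solution-2≤a {a = a} {b} {k} {1}   (inj₁ refl) 2≤a a<b ab+1≡2k =
  no-solution-3-2 2≤a a<b ∘ sum-of-powers-scaled {a} {b} 3 1 k ab+1≡2k
no-solution-2≤a {k = k} {suc (suc w)} (inj₁ refl) = large-w-excluded 3 (suc (suc w)) k (s≤s z≤n) (s≤s (s≤s (s≤s z≤n)))
no-solution-2≤a {k = k} {0}           (inj₂ refl) = small-w-excluded 5 0 k (s≤s (s≤s z≤n))
no-solution-2≤a {k = k} {1}           (inj₂ refl) = small-w-excluded 5 1 k (s≤s (s≤s (s≤s (s≤s z≤n))))
no-solution-2≤a {a = a} {b} {k} {2}   (inj₂ refl) 2≤a a<b ab+1≡2k =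
  no-solution-5-3 2≤a a<b ∘ sum-of-powers-scaled {a} {b} 5 2 k ab+1≡2k
no-solution-2≤a {a = a} {b} {k} {3}   (inj₂ refl) 2≤a a<b ab+1≡2k =
  no-solution-5-4 2≤a a<b ∘ sum-of-powers-scaled {a} {b} 5 3 k ab+1≡2k
no-solution-2≤a {k = k} {suc (suc (suc (suc w)))} (inj₂ refl) =
  large-w-excluded 5 (suc (suc (suc (suc w)))) k (s≤s z≤n) (s≤s (s≤s (s≤s (s≤s (s≤s z≤n)))))

no-solution : ∀ {y a b k w} → y ≡ 3 ⊎ y ≡ 5 → 1 ≤ a → a < b → a * b + 1 ≡ 2 * k → a ^ y + b ^ y ≢ 2 * k ^ suc w
no-solution {y} {a} {b} {k} {w} y∈ 1≤a a<b ab+1≡2k with a ≟ 1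
... | no  a≢1 = no-solution-2≤a {k = k} {w = w} y∈ (≤∧≢⇒< 1≤a (a≢1 ∘ sym)) a<b ab+1≡2k
... | yes refl with b+1≡2k⇒b≡1+2j {k = k} a<b (trans (cong (_+ 1) (sym (*-identityˡ b))) ab+1≡2k)
...   | j , 1≤j , refl , refl = no-solution-a≡1 y∈ j w 1≤j ∘ trans (cong (_+ (1 + 2 * j) ^ y) (sym (^-zeroˡ y)))

lemma2p4 : (k x y z : ℕ) → 1 < k → 0 < x → 0 < y → 0 < z →
    (y ≡ 3 ⊎ y ≡ 5) →
    x ^ 2 + (2 * k ∸ 1) ^ y ≡ k ^ z →
    ¬ (2 ∣ z)
lemma2p4 k x y _ 1<k 0<x _ () y∈ eq (divides zero refl)
lemma2p4 k x y _ 1<k 0<x _ _  y∈ eq (divides (suc w) refl) =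
  let a , b , 1≤a , a<b , ab+1≡2k , sum≡ = even-exponent⇒sum-of-powers {y = y} {w = suc w} 1<k 0<x eq
  in no-solution {k = k} {w = w} y∈ 1≤a a<b ab+1≡2k sum≡
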